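{- Let $n\ge1$ and let $G_6=(V,E)$ be the digraph with $V=\{v,w_1,\dots,w_n\}$ and $E=\{(v,w_k)\mid k=1,\dots,n\}$. Consider Digraph Yama Nim on $G_6$, i.e. the impartial game with positions $(x,y_1,\dots,y_n)\in\mathbb{Z}_{\ge0}^{n+1}$ ($x$ tokens on $v$, $y_j$ tokens on $w_j$) whose options from $(x,y_1,\dots,y_n)$ are $(x-i,y_1+1,\dots,y_n+1)$ for $n+1\le i\le x$, and, for each $j\in\{1,\dots,n\}$, the positions obtained by replacing $y_j$ by $y_j-i$ for $1\le i\le y_j$ (all other coordinates unchanged). Under normal play: (a) if $n$ is odd, the set of $\mathcal{P}$-positions is $\{(x,y_1,\dots,y_n)\mid y_1\oplus\cdots\oplus y_n=0\}$; (b) if $n$ is even, the set of $\mathcal{P}$-positions is $S_1\cup S_2$, where $$S_1=\{(x,y_1,\dots,y_n)\mid x\le n \text{ and } y_1\oplus\cdots\oplus y_n=0\},\qquad S_2=\{(x,y_1,\dots,y_n)\mid x\ge n+1 \text{ and } y_1\oplus\cdots\oplus y_n=1\}.$$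
   Context: Normal play: the player making the last move wins (a player with no options loses). A $\mathcal{P}$-position is one where the previous player (not the player to move) has a winning strategy. $\oplus$ denotes bitwise XOR of non-negative integers. -}

module Defs where

open import Data.Nat using (ℕ; zero; suc; _+_; _∸_; _≤_; _<_; _/_; _%_; _*_)
open import Data.Nat.Properties using (_≟_)
open import Data.Fin using (Fin)
open import Data.Vec using (Vec; []; _∷_; map; foldr; _[_]≔_; lookup)
open import Relation.Nullary using (yes; no)

-- Bitwise XOR on ℕ, computed with a fuel parameter (fuel ≥ a + b + 1 suffices,
-- since both arguments halve at every step).
xorFuel : ℕ → ℕ → ℕ → ℕ
xorFuel zero    a b = 0
xorFuel (suc f) a b = bit + 2 * xorFuel f (a / 2) (b / 2)
  where
  bit : ℕ
  bit with a % 2 ≟ b % 2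
  ... | yes _ = 0
  ... | no  _ = 1

_⊕_ : ℕ → ℕ → ℕ
a ⊕ b = xorFuel (suc (a + b)) a b

infixl 6 _⊕_

xorAll : ∀ {n} → Vec ℕ n → ℕ
xorAll = foldr _ _⊕_ 0

record Pos (n : ℕ) : Set where
  constructor ⟨_,_⟩
  field
    x  : ℕ
    ys : Vec ℕ n

open Pos public

data Move (n : ℕ) : Pos n → Pos n → Set where
  fromV : ∀ x ys i → suc n ≤ i → i ≤ x →
          Move n ⟨ x , ys ⟩ ⟨ x ∸ i , map suc ys ⟩
  fromW : ∀ x ys (j : Fin n) i → 1 ≤ i → i ≤ lookup ys j →
          Move n ⟨ x , ys ⟩ ⟨ x , ys [ j ]≔ (lookup ys j ∸ i) ⟩

mutual
  data IsP (n : ℕ) (p : Pos n) : Set where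
    allN : (∀ q → Move n p q → IsN n q) → IsP n p

  data IsN (n : ℕ) (p : Pos n) : Set where
    someP : ∀ q → Move n p q → IsP n q → IsN n p

{-# OPTIONS --safe #-}
module Submission where

-- A move on a pile w_j changes y_j and hence the nim-sum s = y₁ ⊕ ⋯ ⊕ yₙ, while, as in
-- Nim, lowering a single pile reaches every nim-sum t < s.  A move from v adds a token to
-- every pile and so adds n to the parity of s.  For odd n it flips the parity, so the
-- positions with s = 0 form an independent and absorbing set (a kernel), which in a finite
-- game is the set of P-positions.  For even n a move from v at s = 1 reaches s ≠ 0 by
-- parity and s ≠ 1 because bit 1 of s flips once for every odd pile, and there is an odd
-- number of those; from x ≥ n + 1 and s = 0 one lowers an odd pile by one or, when all
-- piles are even, empties v, which keeps s = 0.

open import Defs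
open import Algebra.Properties.CommutativeSemigroup using (interchange; x∙yz≈y∙xz)
open import Data.Empty using (⊥-elim)
open import Data.Fin using (zero; suc)
open import Data.Fin.Properties using (¬∀⟶∃¬; all?)
open import Data.Nat using (ℕ; zero; suc; _+_; _*_; _∸_; _≤_; _<_; _≥_; _%_; _/_; z≤n; s≤s; _≟_; _≤?_)
open import Data.Nat.DivMod
open import Data.Nat.Divisibility using (m∣m*n)
open import Data.Nat.Induction using (<-rec; <-wellFounded)
open import Data.Nat.Properties
open import Data.Product using (∃-syntax; _×_; _,_; proj₁; proj₂)
open import Data.Sum using (_⊎_; inj₁; inj₂)
open import Data.Vec using (Vec; []; _∷_; map; lookup; _[_]≔_; sum)
open import Data.Vec.Properties using (lookup-map; []≔-lookup)
open import Function.Base using (_∘_)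
open import Function.Bundles using (_⇔_; mk⇔; Equivalence)
open import Induction.WellFounded using (WellFounded; Acc; acc; module Subrelation)
open import Relation.Binary.Definitions using (tri<; tri≈; tri>)
open import Relation.Binary.PropositionalEquality
open import Relation.Nullary using (¬_; yes; no)
open import Relation.Nullary.Decidable using (_×-dec_; _⊎-dec_)
open import Relation.Unary using (Decidable)
import Relation.Binary.Construct.On as On

%2-view : ∀ m → m % 2 ≡ 0 ⊎ m % 2 ≡ 1
%2-view m with m % 2 | m%n<n m 2
... | 0 | _ = inj₁ refl
... | 1 | _ = inj₂ refl
... | suc (suc _) | s≤s (s≤s ())

m%2≢0⇒m%2≡1 : ∀ m → m % 2 ≢ 0 → m % 2 ≡ 1
m%2≢0⇒m%2≡1 m m%2≢0 with %2-view m
... | inj₁ m%2≡0 = ⊥-elim (m%2≢0 m%2≡0)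
... | inj₂ m%2≡1 = m%2≡1

m≡m%2+2*[m/2] : ∀ m → m ≡ m % 2 + 2 * (m / 2)
m≡m%2+2*[m/2] m = trans (m≡m%n+[m/n]*n m 2) (cong (m % 2 +_) (*-comm (m / 2) 2))

[r+2q]%2≡r : ∀ {r} q → r < 2 → (r + 2 * q) % 2 ≡ r
[r+2q]%2≡r {r} q r<2 = trans (%-remove-+ʳ r (m∣m*n q)) (m<n⇒m%n≡m r<2)

[r+2q]/2≡q : ∀ {r} q → r < 2 → (r + 2 * q) / 2 ≡ q
[r+2q]/2≡q {r} q r<2 = begin
  (r + 2 * q) / 2   ≡⟨ +-distrib-/-∣ʳ r (m∣m*n q) ⟩
  r / 2 + 2 * q / 2 ≡⟨ cong₂ _+_ (m<n⇒m/n≡0 r<2) (cong (_/ 2) (*-comm 2 q)) ⟩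
  q * 2 / 2         ≡⟨ m*n/n≡m q 2 ⟩
  q                 ∎
  where open ≡-Reasoning

≡-by-halves : ∀ {m n} → m % 2 ≡ n % 2 → m / 2 ≡ n / 2 → m ≡ n
≡-by-halves {m} {n} ≡%2 ≡/2 = begin
  m                   ≡⟨ m≡m%2+2*[m/2] m ⟩
  m % 2 + 2 * (m / 2) ≡⟨ cong₂ (λ r q → r + 2 * q) ≡%2 ≡/2 ⟩
  n % 2 + 2 * (n / 2) ≡⟨ m≡m%2+2*[m/2] n ⟨
  n                   ∎
  where open ≡-Reasoning

<⇔<-halves : ∀ {m n} → m < n ⇔ (m / 2 < n / 2 ⊎ (m / 2 ≡ n / 2 × m % 2 < n % 2))
<⇔<-halves {m} {n} = mk⇔ to from
  where
  open ≤-Reasoning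
  to : m < n → m / 2 < n / 2 ⊎ (m / 2 ≡ n / 2 × m % 2 < n % 2)
  to m<n with m≤n⇒m<n∨m≡n (/-monoˡ-≤ 2 (<⇒≤ m<n))
  ... | inj₁ m/2<n/2 = inj₁ m/2<n/2
  ... | inj₂ m/2≡n/2 = inj₂ (m/2≡n/2 , +-cancelʳ-< _ _ _ (begin-strict
        m % 2 + 2 * (m / 2) ≡⟨ m≡m%2+2*[m/2] m ⟨
        m                   <⟨ m<n ⟩
        n                   ≡⟨ m≡m%2+2*[m/2] n ⟩
        n % 2 + 2 * (n / 2) ≡⟨ cong (λ q → n % 2 + 2 * q) m/2≡n/2 ⟨
        n % 2 + 2 * (m / 2) ∎))
  from : m / 2 < n / 2 ⊎ (m / 2 ≡ n / 2 × m % 2 < n % 2) → m < n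
  from (inj₁ m/2<n/2) = begin-strict
    m                   ≡⟨ m≡m%2+2*[m/2] m ⟩
    m % 2 + 2 * (m / 2) <⟨ +-monoˡ-< (2 * (m / 2)) (m%n<n m 2) ⟩
    2 + 2 * (m / 2)     ≡⟨ *-suc 2 (m / 2) ⟨
    2 * suc (m / 2)     ≤⟨ *-monoʳ-≤ 2 m/2<n/2 ⟩
    2 * (n / 2)         ≤⟨ m≤n+m _ (n % 2) ⟩
    n % 2 + 2 * (n / 2) ≡⟨ m≡m%2+2*[m/2] n ⟨
    n                   ∎
  from (inj₂ (m/2≡n/2 , m%2<n%2)) = begin-strict
    m                   ≡⟨ m≡m%2+2*[m/2] m ⟩
    m % 2 + 2 * (m / 2) <⟨ +-monoˡ-< (2 * (m / 2)) m%2<n%2 ⟩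
    n % 2 + 2 * (m / 2) ≡⟨ cong (λ q → n % 2 + 2 * q) m/2≡n/2 ⟩
    n % 2 + 2 * (n / 2) ≡⟨ m≡m%2+2*[m/2] n ⟨
    n                   ∎

halving-induction : ∀ {ℓ} (P : ℕ → Set ℓ) → P 0 → (∀ m → P (m / 2) → P m) → ∀ m → P m
halving-induction P P0 step = <-rec P rec
  where
  rec : ∀ m → (∀ {k} → k < m → P k) → P m
  rec zero    _  = P0
  rec (suc m) ih = step (suc m) (ih (m/n<m (suc m) 2 ≤-refl))

m≤1+n⇒m/2≤n : ∀ {m n} → m ≤ suc n → m / 2 ≤ n
m≤1+n⇒m/2≤n {zero}  _       = z≤n
m≤1+n⇒m/2≤n {suc m} m<2+n = <⇒≤pred (<-≤-trans (m/n<m (suc m) 2 ≤-refl) m<2+n)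

+-cong-%2 : ∀ m n p q → m % 2 ≡ n % 2 → p % 2 ≡ q % 2 → (m + p) % 2 ≡ (n + q) % 2
+-cong-%2 m n p q m≡n p≡q = begin
  (m + p) % 2             ≡⟨ %-distribˡ-+ m p 2 ⟩
  (m % 2 + p % 2) % 2     ≡⟨ cong₂ (λ r s → (r + s) % 2) m≡n p≡q ⟩
  (n % 2 + q % 2) % 2     ≡⟨ %-distribˡ-+ n q 2 ⟨
  (n + q) % 2             ∎
  where open ≡-Reasoning

[1+m]/2≡m/2+m%2 : ∀ m → suc m / 2 ≡ m / 2 + m % 2
[1+m]/2≡m/2+m%2 m with m % 2 | m≡m%2+2*[m/2] m | m%n<n m 2
... | 0 | m≡2q | _ = begin
  suc m / 2                 ≡⟨ cong (λ k → suc k / 2) m≡2q ⟩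
  (1 + 2 * (m / 2)) / 2     ≡⟨ [r+2q]/2≡q (m / 2) ≤-refl ⟩
  m / 2                     ≡⟨ +-identityʳ (m / 2) ⟨
  m / 2 + 0                 ∎
  where open ≡-Reasoning
... | 1 | m≡1+2q | _ = begin
  suc m / 2                 ≡⟨ cong (λ k → suc k / 2) m≡1+2q ⟩
  (2 + 2 * (m / 2)) / 2     ≡⟨ cong (_/ 2) (*-suc 2 (m / 2)) ⟨
  (0 + 2 * suc (m / 2)) / 2 ≡⟨ [r+2q]/2≡q (suc (m / 2)) (s≤s z≤n) ⟩
  suc (m / 2)               ≡⟨ +-comm 1 (m / 2) ⟩
  m / 2 + 1                 ∎
  where open ≡-Reasoning
... | suc (suc _) | _ | s≤s (s≤s ())

≡%2⇒[m+n]%2≡0 : ∀ m n → m % 2 ≡ n % 2 → (m + n) % 2 ≡ 0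
≡%2⇒[m+n]%2≡0 m n m≡n = begin
  (m + n) % 2 ≡⟨ +-cong-%2 m m n m refl (sym m≡n) ⟩
  (m + m) % 2 ≡⟨ cong (_% 2) (trans (*-suc m 1) (cong (m +_) (*-identityʳ m))) ⟨
  (m * 2) % 2 ≡⟨ m*n%n≡0 m 2 ⟩
  0           ∎
  where open ≡-Reasoning

≢%2⇒[m+n]%2≡1 : ∀ m n → m % 2 ≢ n % 2 → (m + n) % 2 ≡ 1
≢%2⇒[m+n]%2≡1 m n m≢n with %2-view m | %2-view n
... | inj₁ m%2≡0 | inj₁ n%2≡0 = ⊥-elim (m≢n (trans m%2≡0 (sym n%2≡0)))
... | inj₂ m%2≡1 | inj₂ n%2≡1 = ⊥-elim (m≢n (trans m%2≡1 (sym n%2≡1)))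
... | inj₁ m%2≡0 | inj₂ n%2≡1 = trans (%-distribˡ-+ m n 2) (cong₂ (λ r s → (r + s) % 2) m%2≡0 n%2≡1)
... | inj₂ m%2≡1 | inj₁ n%2≡0 = trans (%-distribˡ-+ m n 2) (cong₂ (λ r s → (r + s) % 2) m%2≡1 n%2≡0)

xorFuel-suc : ∀ f a b → xorFuel (suc f) a b ≡ (a + b) % 2 + 2 * xorFuel f (a / 2) (b / 2)
xorFuel-suc f a b with a % 2 ≟ b % 2
... | yes a≡b = cong (_+ 2 * xorFuel f (a / 2) (b / 2)) (sym (≡%2⇒[m+n]%2≡0 a b a≡b))
... | no  a≢b = cong (_+ 2 * xorFuel f (a / 2) (b / 2)) (sym (≢%2⇒[m+n]%2≡1 a b a≢b))

xorFuel-comm : ∀ f a b → xorFuel f a b ≡ xorFuel f b a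
xorFuel-comm zero    a b = refl
xorFuel-comm (suc f) a b = begin
  xorFuel (suc f) a b                               ≡⟨ xorFuel-suc f a b ⟩
  (a + b) % 2 + 2 * xorFuel f (a / 2) (b / 2)       ≡⟨ cong₂ (λ r q → r % 2 + 2 * q) (+-comm a b) (xorFuel-comm f _ _) ⟩
  (b + a) % 2 + 2 * xorFuel f (b / 2) (a / 2)       ≡⟨ xorFuel-suc f b a ⟨
  xorFuel (suc f) b a                               ∎
  where open ≡-Reasoning

xorFuel-same : ∀ f a → xorFuel f a a ≡ 0
xorFuel-same zero    a = refl
xorFuel-same (suc f) a = begin
  xorFuel (suc f) a a                         ≡⟨ xorFuel-suc f a a ⟩
  (a + a) % 2 + 2 * xorFuel f (a / 2) (a / 2) ≡⟨ cong₂ (λ r q → r + 2 * q) (≡%2⇒[m+n]%2≡0 a a refl) (xorFuel-same f _) ⟩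
  0                                           ∎
  where open ≡-Reasoning

xorFuel-irrelevant : ∀ f g {a b} → a ≤ f → b ≤ f → a ≤ g → b ≤ g → xorFuel f a b ≡ xorFuel g a b
xorFuel-irrelevant zero    g       z≤n z≤n _   _   = sym (xorFuel-same g 0)
xorFuel-irrelevant (suc f) zero    _   _   z≤n z≤n = xorFuel-same (suc f) 0
xorFuel-irrelevant (suc f) (suc g) {a} {b} a≤f b≤f a≤g b≤g = begin
  xorFuel (suc f) a b                         ≡⟨ xorFuel-suc f a b ⟩
  (a + b) % 2 + 2 * xorFuel f (a / 2) (b / 2) ≡⟨ cong (λ q → (a + b) % 2 + 2 * q) (xorFuel-irrelevant f g
                                                   (m≤1+n⇒m/2≤n a≤f) (m≤1+n⇒m/2≤n b≤f) (m≤1+n⇒m/2≤n a≤g) (m≤1+n⇒m/2≤n b≤g)) ⟩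
  (a + b) % 2 + 2 * xorFuel g (a / 2) (b / 2) ≡⟨ xorFuel-suc g a b ⟨
  xorFuel (suc g) a b                         ∎
  where open ≡-Reasoning

⊕-unfold : ∀ a b → a ⊕ b ≡ (a + b) % 2 + 2 * (a / 2 ⊕ b / 2)
⊕-unfold a b = trans (xorFuel-suc (a + b) a b) (cong (λ q → (a + b) % 2 + 2 * q)
  (xorFuel-irrelevant (a + b) (suc (a / 2 + b / 2))
    (≤-trans (m/n≤m a 2) (m≤m+n a b)) (≤-trans (m/n≤m b 2) (m≤n+m b a))
    (m≤n⇒m≤1+n (m≤m+n _ _)) (m≤n⇒m≤1+n (m≤n+m _ _))))

⊕-%2 : ∀ a b → (a ⊕ b) % 2 ≡ (a + b) % 2
⊕-%2 a b = trans (cong (_% 2) (⊕-unfold a b)) ([r+2q]%2≡r (a / 2 ⊕ b / 2) (m%n<n (a + b) 2))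

⊕-/2 : ∀ a b → (a ⊕ b) / 2 ≡ a / 2 ⊕ b / 2
⊕-/2 a b = trans (cong (_/ 2) (⊕-unfold a b)) ([r+2q]/2≡q (a / 2 ⊕ b / 2) (m%n<n (a + b) 2))

⊕-comm : ∀ a b → a ⊕ b ≡ b ⊕ a
⊕-comm a b = trans (xorFuel-comm (suc (a + b)) a b) (cong (λ f → xorFuel (suc f) b a) (+-comm a b))

⊕-same : ∀ a → a ⊕ a ≡ 0
⊕-same a = xorFuel-same (suc (a + a)) a

⊕-identityʳ : ∀ a → a ⊕ 0 ≡ a
⊕-identityʳ = halving-induction _ refl λ a ih →
  ≡-by-halves (trans (⊕-%2 a 0) (cong (_% 2) (+-identityʳ a))) (trans (⊕-/2 a 0) ih)

⊕-identityˡ : ∀ a → 0 ⊕ a ≡ a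
⊕-identityˡ a = trans (⊕-comm 0 a) (⊕-identityʳ a)

⊕-assoc : ∀ a b c → (a ⊕ b) ⊕ c ≡ a ⊕ (b ⊕ c)
⊕-assoc = halving-induction _ (λ b c → trans (cong (_⊕ c) (⊕-identityˡ b)) (sym (⊕-identityˡ (b ⊕ c)))) step
  where
  step : ∀ a → (∀ b c → (a / 2 ⊕ b) ⊕ c ≡ a / 2 ⊕ (b ⊕ c)) → ∀ b c → (a ⊕ b) ⊕ c ≡ a ⊕ (b ⊕ c)
  step a ih b c = ≡-by-halves
    (begin
      ((a ⊕ b) ⊕ c) % 2 ≡⟨ ⊕-%2 (a ⊕ b) c ⟩
      ((a ⊕ b) + c) % 2 ≡⟨ +-cong-%2 (a ⊕ b) (a + b) c c (⊕-%2 a b) refl ⟩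
      ((a + b) + c) % 2 ≡⟨ cong (_% 2) (+-assoc a b c) ⟩
      (a + (b + c)) % 2 ≡⟨ +-cong-%2 a a (b ⊕ c) (b + c) refl (⊕-%2 b c) ⟨
      (a + (b ⊕ c)) % 2 ≡⟨ ⊕-%2 a (b ⊕ c) ⟨
      (a ⊕ (b ⊕ c)) % 2 ∎)
    (begin
      ((a ⊕ b) ⊕ c) / 2         ≡⟨ ⊕-/2 (a ⊕ b) c ⟩
      (a ⊕ b) / 2 ⊕ c / 2       ≡⟨ cong (_⊕ c / 2) (⊕-/2 a b) ⟩
      (a / 2 ⊕ b / 2) ⊕ c / 2   ≡⟨ ih (b / 2) (c / 2) ⟩
      a / 2 ⊕ (b / 2 ⊕ c / 2)   ≡⟨ cong (a / 2 ⊕_) (⊕-/2 b c) ⟨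
      a / 2 ⊕ (b ⊕ c) / 2       ≡⟨ ⊕-/2 a (b ⊕ c) ⟨
      (a ⊕ (b ⊕ c)) / 2         ∎)
    where open ≡-Reasoning

⊕-⊕-cancelˡ : ∀ a b → a ⊕ (a ⊕ b) ≡ b
⊕-⊕-cancelˡ a b = begin
  a ⊕ (a ⊕ b) ≡⟨ ⊕-assoc a a b ⟨
  (a ⊕ a) ⊕ b ≡⟨ cong (_⊕ b) (⊕-same a) ⟩
  0 ⊕ b       ≡⟨ ⊕-identityˡ b ⟩
  b           ∎
  where open ≡-Reasoning

⊕-cancelˡ : ∀ a {b c} → a ⊕ b ≡ a ⊕ c → b ≡ c
⊕-cancelˡ a {b} {c} a⊕b≡a⊕c =
  trans (sym (⊕-⊕-cancelˡ a b)) (trans (cong (a ⊕_) a⊕b≡a⊕c) (⊕-⊕-cancelˡ a c))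

xorAll-map-/2 : ∀ {n} (ys : Vec ℕ n) → xorAll (map (_/ 2) ys) ≡ xorAll ys / 2
xorAll-map-/2 []       = refl
xorAll-map-/2 (y ∷ ys) = trans (cong (y / 2 ⊕_) (xorAll-map-/2 ys)) (sym (⊕-/2 y (xorAll ys)))

xorAll-[]≔-⊕ : ∀ {n} (ys : Vec ℕ n) j c → xorAll (ys [ j ]≔ (lookup ys j ⊕ c)) ≡ xorAll ys ⊕ c
xorAll-[]≔-⊕ (y ∷ ys) zero    c = begin
  (y ⊕ c) ⊕ xorAll ys ≡⟨ ⊕-assoc y c _ ⟩
  y ⊕ (c ⊕ xorAll ys) ≡⟨ cong (y ⊕_) (⊕-comm c _) ⟩
  y ⊕ (xorAll ys ⊕ c) ≡⟨ ⊕-assoc y _ c ⟨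
  (y ⊕ xorAll ys) ⊕ c ∎
  where open ≡-Reasoning
xorAll-[]≔-⊕ (y ∷ ys) (suc j) c = trans (cong (y ⊕_) (xorAll-[]≔-⊕ ys j c)) (sym (⊕-assoc y _ c))

xorAll-[]≔-injective : ∀ {n} (ys : Vec ℕ n) j {v w} → xorAll (ys [ j ]≔ v) ≡ xorAll (ys [ j ]≔ w) → v ≡ w
xorAll-[]≔-injective (y ∷ ys) zero    {v} {w} eq = ⊕-cancelˡ (xorAll ys) (trans (⊕-comm _ v) (trans eq (⊕-comm w _)))
xorAll-[]≔-injective (y ∷ ys) (suc j) eq = xorAll-[]≔-injective ys j (⊕-cancelˡ y eq)

even-piles⇒even-xorAll : ∀ {n} (ys : Vec ℕ n) → (∀ j → lookup ys j % 2 ≡ 0) → xorAll ys % 2 ≡ 0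
even-piles⇒even-xorAll []       _     = refl
even-piles⇒even-xorAll (y ∷ ys) even = trans (⊕-%2 y (xorAll ys))
  (+-cong-%2 y 0 (xorAll ys) 0 (even zero) (even-piles⇒even-xorAll ys (even ∘ suc)))

odd-xorAll⇒odd-pile : ∀ {n} (ys : Vec ℕ n) → xorAll ys % 2 ≢ 0 → ∃[ j ] lookup ys j % 2 ≢ 0
odd-xorAll⇒odd-pile {n} ys odd = ¬∀⟶∃¬ n (λ j → lookup ys j % 2 ≡ 0) (λ j → lookup ys j % 2 ≟ 0) (odd ∘ even-piles⇒even-xorAll ys)

%2≢0⇒⊕1< : ∀ {a} → a % 2 ≢ 0 → a ⊕ 1 < a
%2≢0⇒⊕1< {a} a%2≢0 = Equivalence.from <⇔<-halves (inj₂ (halves , parities))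
  where
  a%2≡1 : a % 2 ≡ 1
  a%2≡1 = m%2≢0⇒m%2≡1 a a%2≢0
  halves : (a ⊕ 1) / 2 ≡ a / 2
  halves = trans (⊕-/2 a 1) (⊕-identityʳ (a / 2))
  parities : (a ⊕ 1) % 2 < a % 2
  parities = subst₂ _<_ (sym (trans (⊕-%2 a 1) (≡%2⇒[m+n]%2≡0 a 1 a%2≡1))) (sym a%2≡1) (s≤s z≤n)

pile-lowering : ∀ c {n} (ys : Vec ℕ n) → xorAll ys ⊕ c < xorAll ys → ∃[ j ] lookup ys j ⊕ c < lookup ys j
pile-lowering = halving-induction Lowerable (λ ys lt → ⊥-elim (<-irrefl (⊕-identityʳ (xorAll ys)) lt)) step
  where
  Lowerable : ℕ → Set
  Lowerable c = ∀ {n} (ys : Vec ℕ n) → xorAll ys ⊕ c < xorAll ys → ∃[ j ] lookup ys j ⊕ c < lookup ys j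

  -- Either the halves of the nim-sum already drop, and we recurse on the halved piles, or
  -- only its last bit drops, which forces c = 1 and an odd nim-sum, hence an odd pile.
  step : ∀ c → Lowerable (c / 2) → Lowerable c
  step c ih ys lt with Equivalence.to <⇔<-halves lt
  ... | inj₁ lt/2 = j , Equivalence.from <⇔<-halves (inj₁ (subst (_< y / 2) (sym (⊕-/2 y c)) y/2⊕c/2<y/2))
    where
    halved : xorAll (map (_/ 2) ys) ⊕ c / 2 < xorAll (map (_/ 2) ys)
    halved = subst (λ h → h ⊕ c / 2 < h) (sym (xorAll-map-/2 ys)) (subst (_< xorAll ys / 2) (⊕-/2 (xorAll ys) c) lt/2)
    j = proj₁ (ih (map (_/ 2) ys) halved)
    y = lookup ys j
    y/2⊕c/2<y/2 : y / 2 ⊕ c / 2 < y / 2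
    y/2⊕c/2<y/2 = subst (λ h → h ⊕ c / 2 < h) (lookup-map j (_/ 2) ys) (proj₂ (ih (map (_/ 2) ys) halved))
  ... | inj₂ (eq/2 , lt%2) = j , subst (λ c → lookup ys j ⊕ c < lookup ys j) (sym c≡1) (%2≢0⇒⊕1< y%2≢0)
    where
    s = xorAll ys
    c/2≡0 : c / 2 ≡ 0
    c/2≡0 = ⊕-cancelˡ (s / 2) (trans (sym (⊕-/2 s c)) (trans eq/2 (sym (⊕-identityʳ (s / 2)))))
    c≢0 : c ≢ 0
    c≢0 refl = <-irrefl (⊕-identityʳ s) lt
    c≡1 : c ≡ 1
    c≡1 = ≡-by-halves (m%2≢0⇒m%2≡1 c (λ c%2≡0 → c≢0 (≡-by-halves c%2≡0 c/2≡0))) c/2≡0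
    s%2≢0 : s % 2 ≢ 0
    s%2≢0 s%2≡0 = n≮0 (subst ((s ⊕ c) % 2 <_) s%2≡0 lt%2)
    j = proj₁ (odd-xorAll⇒odd-pile ys s%2≢0)
    y%2≢0 = proj₂ (odd-xorAll⇒odd-pile ys s%2≢0)

xorAll-map-suc-%2 : ∀ {n} (ys : Vec ℕ n) → xorAll (map suc ys) % 2 ≡ (xorAll ys + n) % 2
xorAll-map-suc-%2 []               = refl
xorAll-map-suc-%2 {suc n} (y ∷ ys) = begin
  (suc y ⊕ S′) % 2        ≡⟨ ⊕-%2 (suc y) S′ ⟩
  (suc y + S′) % 2        ≡⟨ +-cong-%2 (suc y) (suc y) S′ (S + n) refl (xorAll-map-suc-%2 ys) ⟩
  (suc y + (S + n)) % 2   ≡⟨ cong (_% 2) (trans (cong suc (sym (+-assoc y S n))) (sym (+-suc (y + S) n))) ⟩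
  (y + S + suc n) % 2     ≡⟨ +-cong-%2 (y ⊕ S) (y + S) (suc n) (suc n) (⊕-%2 y S) refl ⟨
  (y ⊕ S + suc n) % 2     ∎
  where
  open ≡-Reasoning
  S  = xorAll ys
  S′ = xorAll (map suc ys)

xorAll-map-suc-/2%2 : ∀ {n} (ys : Vec ℕ n) → xorAll (map suc ys) / 2 % 2 ≡ (xorAll ys / 2 + xorAll ys) % 2
xorAll-map-suc-/2%2 []       = refl
xorAll-map-suc-/2%2 (y ∷ ys) = begin
  (suc y ⊕ S′) / 2 % 2                    ≡⟨ cong (_% 2) (⊕-/2 (suc y) S′) ⟩
  (suc y / 2 ⊕ S′ / 2) % 2                ≡⟨ ⊕-%2 (suc y / 2) (S′ / 2) ⟩
  (suc y / 2 + S′ / 2) % 2                ≡⟨ +-cong-%2 (suc y / 2) (y / 2 + y) (S′ / 2) (S / 2 + S)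
                                               (trans (cong (_% 2) ([1+m]/2≡m/2+m%2 y))
                                                      (+-cong-%2 (y / 2) (y / 2) (y % 2) y refl (m%n%n≡m%n y 2)))
                                               (xorAll-map-suc-/2%2 ys) ⟩
  ((y / 2 + y) + (S / 2 + S)) % 2         ≡⟨ cong (_% 2) (interchange +-commutativeSemigroup (y / 2) y (S / 2) S) ⟩
  ((y / 2 + S / 2) + (y + S)) % 2         ≡⟨ +-cong-%2 (y / 2 ⊕ S / 2) (y / 2 + S / 2) (y ⊕ S) (y + S)
                                               (⊕-%2 (y / 2) (S / 2)) (⊕-%2 y S) ⟨
  ((y / 2 ⊕ S / 2) + (y ⊕ S)) % 2         ≡⟨ cong (λ h → (h + (y ⊕ S)) % 2) (⊕-/2 y S) ⟨
  ((y ⊕ S) / 2 + (y ⊕ S)) % 2             ∎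
  where
  open ≡-Reasoning
  S  = xorAll ys
  S′ = xorAll (map suc ys)

xorAll-map-suc-/2 : ∀ {n} (ys : Vec ℕ n) → (∀ j → lookup ys j % 2 ≡ 0) → xorAll (map suc ys) / 2 ≡ xorAll ys / 2
xorAll-map-suc-/2 []       _    = refl
xorAll-map-suc-/2 (y ∷ ys) even = begin
  (suc y ⊕ xorAll (map suc ys)) / 2     ≡⟨ ⊕-/2 (suc y) _ ⟩
  suc y / 2 ⊕ xorAll (map suc ys) / 2   ≡⟨ cong₂ _⊕_ [1+y]/2≡y/2 (xorAll-map-suc-/2 ys (even ∘ suc)) ⟩
  y / 2 ⊕ xorAll ys / 2                 ≡⟨ ⊕-/2 y (xorAll ys) ⟨
  (y ⊕ xorAll ys) / 2                   ∎
  where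
  open ≡-Reasoning
  [1+y]/2≡y/2 : suc y / 2 ≡ y / 2
  [1+y]/2≡y/2 = trans ([1+m]/2≡m/2+m%2 y) (trans (cong (y / 2 +_) (even zero)) (+-identityʳ (y / 2)))

IsP⇒¬IsN : ∀ {n p} → IsP n p → ¬ IsN n p
IsP⇒¬IsN (allN options) (someP q p→q isP) = IsP⇒¬IsN isP (options q p→q)

size : ∀ {n} → Pos n → ℕ
size p = x p + sum (ys p)

sum-map-suc : ∀ {n} (ys : Vec ℕ n) → sum (map suc ys) ≡ n + sum ys
sum-map-suc []       = refl
sum-map-suc (y ∷ ys) = cong suc (trans (cong (y +_) (sum-map-suc ys)) (x∙yz≈y∙xz +-commutativeSemigroup y _ (sum ys)))

sum-[]≔-< : ∀ {n} (ys : Vec ℕ n) j {v} → v < lookup ys j → sum (ys [ j ]≔ v) < sum ys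
sum-[]≔-< (y ∷ ys) zero    v<y = +-monoˡ-< (sum ys) v<y
sum-[]≔-< (y ∷ ys) (suc j) v<l = +-monoʳ-< y (sum-[]≔-< ys j v<l)

m∸n<m : ∀ {m n} → 0 < n → n ≤ m → m ∸ n < m
m∸n<m 0<n n≤m = ∸-monoʳ-< 0<n n≤m

Move⇒size< : ∀ {n p q} → Move n p q → size q < size p
Move⇒size< {n} (fromV x ys i n<i i≤x) = begin-strict
  x ∸ i + sum (map suc ys) ≡⟨ cong (x ∸ i +_) (sum-map-suc ys) ⟩
  x ∸ i + (n + sum ys)     <⟨ +-monoʳ-< (x ∸ i) (+-monoˡ-< (sum ys) n<i) ⟩
  x ∸ i + (i + sum ys)     ≡⟨ +-assoc (x ∸ i) i (sum ys) ⟨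
  x ∸ i + i + sum ys       ≡⟨ cong (_+ sum ys) (m∸n+n≡m i≤x) ⟩
  x + sum ys               ∎
  where open ≤-Reasoning
Move⇒size< (fromW x ys j i 1≤i i≤y) = +-monoʳ-< x (sum-[]≔-< ys j (m∸n<m 1≤i i≤y))

Move-wellFounded : ∀ {n} → WellFounded (λ q p → Move n p q)
Move-wellFounded = Subrelation.wellFounded Move⇒size< (On.wellFounded size <-wellFounded)

IsP⇔kernel : ∀ {n} (K : Pos n → Set) → Decidable K →
             (∀ {p q} → Move n p q → K p → ¬ K q) →
             (∀ {p} → ¬ K p → ∃[ q ] Move n p q × K q) →
             ∀ p → IsP n p ⇔ K p
IsP⇔kernel {n} K K? independent absorbing p = mk⇔ to (proj₁ (classify (Move-wellFounded p)))
  where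
  classify : ∀ {p} → Acc (λ q p → Move n p q) p → (K p → IsP n p) × (¬ K p → IsN n p)
  classify (acc rec) =
    (λ k → allN λ q p→q → proj₂ (classify (rec p→q)) (independent p→q k)) ,
    (λ ¬k → let q , p→q , kq = absorbing ¬k in someP q p→q (proj₁ (classify (rec p→q)) kq))
  to : IsP n p → K p
  to isP with K? p
  ... | yes k = k
  ... | no ¬k = ⊥-elim (IsP⇒¬IsN isP (proj₂ (classify (Move-wellFounded p)) ¬k))

⊕-lowering-move : ∀ {n} x (ys : Vec ℕ n) j {c} → lookup ys j ⊕ c < lookup ys j →
                  ∃[ ys′ ] Move n ⟨ x , ys ⟩ ⟨ x , ys′ ⟩ × xorAll ys′ ≡ xorAll ys ⊕ c
⊕-lowering-move {n} x ys j {c} lt = ys [ j ]≔ v , move , xorAll-[]≔-⊕ ys j c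
  where
  l = lookup ys j
  v = l ⊕ c
  move : Move n ⟨ x , ys ⟩ ⟨ x , ys [ j ]≔ v ⟩
  move = subst (λ w → Move n ⟨ x , ys ⟩ ⟨ x , ys [ j ]≔ w ⟩) (m∸[m∸n]≡n (<⇒≤ lt))
           (fromW x ys j (l ∸ v) (m<n⇒0<n∸m lt) (m∸n≤m l v))

smaller-xorAll-move : ∀ {n} x (ys : Vec ℕ n) {t} → t < xorAll ys →
                      ∃[ ys′ ] Move n ⟨ x , ys ⟩ ⟨ x , ys′ ⟩ × xorAll ys′ ≡ t
smaller-xorAll-move x ys {t} t<s =
  let j , lt = pile-lowering (s ⊕ t) ys (subst (_< s) (sym (⊕-⊕-cancelˡ s t)) t<s)
      ys′ , move , s′≡s⊕[s⊕t] = ⊕-lowering-move x ys j lt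
  in ys′ , move , trans s′≡s⊕[s⊕t] (⊕-⊕-cancelˡ s t)
  where s = xorAll ys

fromW-changes-xorAll : ∀ {n} (ys : Vec ℕ n) j {i} → 1 ≤ i → i ≤ lookup ys j →
                       xorAll (ys [ j ]≔ (lookup ys j ∸ i)) ≢ xorAll ys
fromW-changes-xorAll ys j 1≤i i≤y eq =
  <⇒≢ (m∸n<m 1≤i i≤y) (xorAll-[]≔-injective ys j (trans eq (cong xorAll (sym ([]≔-lookup ys j)))))

xorAll≡1⇒xorAll-map-suc≢1 : ∀ {n} (ys : Vec ℕ n) → xorAll ys ≡ 1 → xorAll (map suc ys) ≢ 1
xorAll≡1⇒xorAll-map-suc≢1 ys s≡1 s′≡1 = 0≢1+n (begin
  0                                   ≡⟨ cong (λ s′ → s′ / 2 % 2) s′≡1 ⟨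
  xorAll (map suc ys) / 2 % 2         ≡⟨ xorAll-map-suc-/2%2 ys ⟩
  (xorAll ys / 2 + xorAll ys) % 2     ≡⟨ cong (λ s → (s / 2 + s) % 2) s≡1 ⟩
  1                                   ∎)
  where open ≡-Reasoning

Podd : ∀ n → Pos n → Set
Podd n p = xorAll (ys p) ≡ 0

Podd? : ∀ {n} → Decidable (Podd n)
Podd? p = xorAll (ys p) ≟ 0

Podd-independent : ∀ {n} → n % 2 ≡ 1 → ∀ {p q} → Move n p q → Podd n p → ¬ Podd n q
Podd-independent {n} n-odd (fromV x ys i _ _) s≡0 s′≡0 = 0≢1+n (begin
  0                          ≡⟨ cong (_% 2) s′≡0 ⟨
  xorAll (map suc ys) % 2    ≡⟨ xorAll-map-suc-%2 ys ⟩
  (xorAll ys + n) % 2        ≡⟨ cong (λ s → (s + n) % 2) s≡0 ⟩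
  n % 2                      ≡⟨ n-odd ⟩
  1                          ∎)
  where open ≡-Reasoning
Podd-independent _ (fromW x ys j i 1≤i i≤y) s≡0 s′≡0 = fromW-changes-xorAll ys j 1≤i i≤y (trans s′≡0 (sym s≡0))

Podd-absorbing : ∀ {n p} → ¬ Podd n p → ∃[ q ] Move n p q × Podd n q
Podd-absorbing {p = ⟨ x , ys ⟩} s≢0 =
  let ys′ , move , s′≡0 = smaller-xorAll-move x ys (n≢0⇒n>0 s≢0) in ⟨ x , ys′ ⟩ , move , s′≡0

Peven : ∀ n → Pos n → Set
Peven n p = (x p ≤ n × xorAll (ys p) ≡ 0) ⊎ (x p ≥ suc n × xorAll (ys p) ≡ 1)

Peven? : ∀ {n} → Decidable (Peven n)
Peven? {n} p = (x p ≤? n ×-dec xorAll (ys p) ≟ 0) ⊎-dec (suc n ≤? x p ×-dec xorAll (ys p) ≟ 1)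

Peven-independent : ∀ {n} → n % 2 ≡ 0 → ∀ {p q} → Move n p q → Peven n p → ¬ Peven n q
Peven-independent _ (fromV x ys i n<i i≤x) (inj₁ (x≤n , _)) _ = <⇒≱ (<-≤-trans n<i i≤x) x≤n
Peven-independent {n} n-even (fromV x ys i _ _) (inj₂ (_ , s≡1)) (inj₁ (_ , s′≡0)) = 0≢1+n (begin
  0                          ≡⟨ cong (_% 2) s′≡0 ⟨
  xorAll (map suc ys) % 2    ≡⟨ xorAll-map-suc-%2 ys ⟩
  (xorAll ys + n) % 2        ≡⟨ +-cong-%2 (xorAll ys) 1 n 0 (cong (_% 2) s≡1) n-even ⟩
  1                          ∎)
  where open ≡-Reasoning
Peven-independent _ (fromV x ys i _ _) (inj₂ (_ , s≡1)) (inj₂ (_ , s′≡1)) = xorAll≡1⇒xorAll-map-suc≢1 ys s≡1 s′≡1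
Peven-independent _ (fromW x ys j i 1≤i i≤y) (inj₁ (_ , s≡0)) (inj₁ (_ , s′≡0)) =
  fromW-changes-xorAll ys j 1≤i i≤y (trans s′≡0 (sym s≡0))
Peven-independent _ (fromW x ys j i 1≤i i≤y) (inj₂ (_ , s≡1)) (inj₂ (_ , s′≡1)) =
  fromW-changes-xorAll ys j 1≤i i≤y (trans s′≡1 (sym s≡1))
Peven-independent _ (fromW _ _ _ _ _ _) (inj₁ (x≤n , _)) (inj₂ (n<x , _)) = <⇒≱ n<x x≤n
Peven-independent _ (fromW _ _ _ _ _ _) (inj₂ (n<x , _)) (inj₁ (x≤n , _)) = <⇒≱ n<x x≤n

Peven-absorbing-x>n-xorAll≡0 : ∀ {n} → n % 2 ≡ 0 → ∀ {x} (ys : Vec ℕ n) → x ≥ suc n → xorAll ys ≡ 0 →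
                           ∃[ q ] Move n ⟨ x , ys ⟩ q × Peven n q
Peven-absorbing-x>n-xorAll≡0 {n} n-even {x} ys n<x s≡0 with all? (λ j → lookup ys j % 2 ≟ 0)
... | yes even = ⟨ x ∸ x , map suc ys ⟩ , fromV x ys x n<x ≤-refl , inj₁ (subst (_≤ n) (sym (n∸n≡0 x)) z≤n , s′≡0)
  where
  s′≡0 : xorAll (map suc ys) ≡ 0
  s′≡0 = ≡-by-halves
    (trans (xorAll-map-suc-%2 ys) (trans (cong (λ s → (s + n) % 2) s≡0) n-even))
    (trans (xorAll-map-suc-/2 ys even) (cong (_/ 2) s≡0))
... | no ¬even =
  let j , odd = ¬∀⟶∃¬ n _ (λ j → lookup ys j % 2 ≟ 0) ¬even
      ys′ , move , s′≡s⊕1 = ⊕-lowering-move x ys j (%2≢0⇒⊕1< odd)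
  in ⟨ x , ys′ ⟩ , move , inj₂ (n<x , trans s′≡s⊕1 (cong (_⊕ 1) s≡0))

Peven-absorbing-x>n : ∀ {n} → n % 2 ≡ 0 → ∀ {x} (ys : Vec ℕ n) → x ≥ suc n → xorAll ys ≢ 1 →
                        ∃[ q ] Move n ⟨ x , ys ⟩ q × Peven n q
Peven-absorbing-x>n n-even {x} ys n<x s≢1 with <-cmp 1 (xorAll ys)
... | tri< 1<s _ _ = let ys′ , move , s′≡1 = smaller-xorAll-move x ys 1<s in ⟨ x , ys′ ⟩ , move , inj₂ (n<x , s′≡1)
... | tri≈ _ 1≡s _ = ⊥-elim (s≢1 (sym 1≡s))
... | tri> _ _ s<1 = Peven-absorbing-x>n-xorAll≡0 n-even ys n<x (n<1⇒n≡0 s<1)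

Peven-absorbing : ∀ {n} → n % 2 ≡ 0 → ∀ {p} → ¬ Peven n p → ∃[ q ] Move n p q × Peven n q
Peven-absorbing {n} n-even {⟨ x , ys ⟩} ¬k with x ≤? n
... | yes x≤n = let ys′ , move , s′≡0 = smaller-xorAll-move x ys (n≢0⇒n>0 (λ s≡0 → ¬k (inj₁ (x≤n , s≡0))))
                in ⟨ x , ys′ ⟩ , move , inj₁ (x≤n , s′≡0)
... | no x≰n = Peven-absorbing-x>n n-even ys (≰⇒> x≰n) (λ s≡1 → ¬k (inj₂ (≰⇒> x≰n , s≡1)))

corollary11 : (n : ℕ) → 1 ≤ n →
    ((n % 2 ≡ 1 → (p : Pos n) → IsP n p ⇔ (xorAll (ys p) ≡ 0))
    × (n % 2 ≡ 0 → (p : Pos n) →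
        IsP n p ⇔ ((x p ≤ n × xorAll (ys p) ≡ 0) ⊎ (x p ≥ suc n × xorAll (ys p) ≡ 1))))
corollary11 n _ =
  (λ n-odd  → IsP⇔kernel (Podd n)  Podd?  (Podd-independent n-odd)   Podd-absorbing) ,
  (λ n-even → IsP⇔kernel (Peven n) Peven? (Peven-independent n-even) (Peven-absorbing n-even))
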